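{- Let $\mathcal{D}$ be the arena of a playable $p$-periodic temporal graph on vertex set $V$, let $k\ge1$, and let $\mathcal{A}^k$ be an augmented $k$-arena of $\mathcal{D}$. Let $t\in\mathbb{Z}_p$, $X=\langle x_1,\dots,x_k\rangle\in[V]^k$, $y\in V$ and $Z=\langle z_1,\dots,z_k\rangle\in[V]^k$, and suppose there is a bijection between the elements of $X$ and $Z$ (as multisets) matching each $x_i$ with some $z_{\pi(i)}\in\Gamma_t(x_i,\mathcal{D})$. If $(t,y)$ is a shadow $k$-corner of $(t+1,Z)$ with respect to $\mathcal{A}^k$, then $\mathcal{A}^k\cup\{((t,X),(t+1,y))\}$ is an augmented $k$-arena of $\mathcal{D}$.
   Context: Let $V$ be a finite set of $n$ vertices and $p\ge 1$ an integer. A $p$-periodic temporal graph $\mathcal{G}=(G_0,\dots,G_{p-1})^*$ is the infinite sequence of directed graphs whose snapshot at time $t\in\{0,1,2,\dots\}$ is $G_{t\bmod p}=(V,E_{t\bmod p})$, where each $E_i\subseteq V\times V$ may contain self-loops, and every vertex of every $G_i$ has at least one outgoing edge (playable). Slice indices are taken modulo $p$. The arena of $\mathcal{G}$ is the directed graph $\mathcal{D}$ on $\mathbb{Z}_p\times V$ with $((i,u),(i+1,v))\in E(\mathcal{D})$ iff $(u,v)\in E_i$; write $\Gamma_t(u,\mathcal{D})=\{v:((t,u),(t+1,v))\in E(\mathcal{D})\}$. $[V]^k$ denotes the set of multisets of $k$ elements of $V$. Game with $k$ cops and one robber (restless, full information): in each round $t$, first every cop simultaneously moves from its vertex $c$ to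 some vertex of $\Gamma_{t\bmod p}(c,\mathcal{D})$, then the robber moves from $r$ to some $r'\in\Gamma_{t\bmod p}(r,\mathcal{D})$. The cops win if some cop moves onto the robber's current vertex (a position where the robber shares a vertex with a cop counts as capture); the robber wins by avoiding capture forever. A configuration $(t,C,r)$ (cops at $C\in[V]^k$, robber at $r$ at the start of round $t$, cops to move) is $k$-copwin if the cops have a strategy guaranteeing capture from it; this depends only on $t\bmod p$. A hyperedge is a pair $((t,X),(t+1,y))$ with $t\in\mathbb{Z}_p$, $X\in[V]^k$ and $y\in V$. The $k$-arena $\mathcal{D}^k$ has as hyperedges all $((t,X),(t+1,y))$ such that some $x\in X$ has $((t,x),(t+1,y))\in E(\mathcal{D})$. An augmented $k$-arena of $\mathcal{D}$ is a set $\mathcal{A}^k$ of hyperedges containing all hyperedges of $\mathcal{D}^k$ such that for every $((t,X),(t+1,y))\in\mathcal{A}^k$ the configuration $(t,X,y)$ is $k$-copwin. Write $\Gamma_{t}(X,\mathcal{A}^k)=\{w\in V:((t,X),(t+1,w))\in\mathcal{A}^k\}$. A temporal node $(t,y)$ is a shadow $k$-corner of $(t+1,Z)$, $Z\in[V]^k$ (and $(t+1,Z)$ a shadow $k$-cover of $(t,y)$), if $y\notin Z$ and $\Gamma_t(y,\mathcal{D})\subseteq\Gamma_{t+1}(Z,\mathcal{A}^k)$. -}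

module Defs where

open import Data.Nat using (ℕ; zero; suc; NonZero; _≥_)
open import Data.Nat.DivMod using (_%_; m%n<n)
open import Data.Fin using (Fin; toℕ; fromℕ<)
open import Data.Vec using (Vec; lookup; toList)
open import Data.Product using (Σ; ∃; _×_; _,_)
open import Data.Sum using (_⊎_)
open import Data.List.Relation.Binary.Permutation.Propositional using (_↭_)
open import Relation.Binary.PropositionalEquality using (_≡_)
open import Relation.Nullary using (¬_)

-- Snapshots of a p-periodic temporal graph on vertex set V = Fin n:
-- E i u v  means (u,v) ∈ E_i, for i ∈ ℤ_p represented by Fin p.
-- This also encodes the arena D: ((i,u),(i+1,v)) ∈ E(D) iff E i u v,
-- so Γ_i(u,D) = { v | E i u v }.
Snapshots : ℕ → ℕ → Set₁
Snapshots n p = Fin p → Fin n → Fin n → Set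

next : ∀ {p} .{{_ : NonZero p}} → Fin p → Fin p
next {p} i = fromℕ< (m%n<n (suc (toℕ i)) p)

Playable : ∀ {n p} → Snapshots n p → Set
Playable {n} {p} E = ∀ (i : Fin p) (u : Fin n) → ∃ λ v → E i u v

_∈ᵐ_ : ∀ {n k} → Fin n → Vec (Fin n) k → Set
_∈ᵐ_ {k = k} v X = ∃ λ (i : Fin k) → lookup X i ≡ v

-- Cops-and-robber game (restless, full information), k cops.
-- CopWin E t C r : the configuration (t,C,r) (cops at C, robber at r at the
-- start of round t, cops to move) is k-copwin, i.e. the cops can force capture.
-- Defined inductively as the cops' attractor (winning region of the
-- reachability game).
data CopWin {n p k : ℕ} .{{_ : NonZero p}} (E : Snapshots n p)
       : Fin p → Vec (Fin n) k → Fin n → Set where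
  caught : ∀ {t C r} → r ∈ᵐ C → CopWin E t C r
  move   : ∀ {t C r} (C' : Vec (Fin n) k)
         → (∀ i → E t (lookup C i) (lookup C' i))
         → (r ∈ᵐ C' ⊎ (∀ r' → E t r r' → CopWin E (next t) C' r'))
         → CopWin E t C r

-- sets of hyperedges ((t,X),(t+1,y)), X ∈ [V]^k represented by a vector
HyperedgeSet : ℕ → ℕ → ℕ → Set₁
HyperedgeSet n p k = Fin p → Vec (Fin n) k → Fin n → Set

Dk : ∀ {n p k} → Snapshots n p → HyperedgeSet n p k
Dk {k = k} E t X y = ∃ λ (i : Fin k) → E t (lookup X i) y

-- A hyperedge set is a set of multiset-hyperedges: invariant under reordering X
MultisetClosed : ∀ {n p k} → HyperedgeSet n p k → Set
MultisetClosed {n} {p} {k} A =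
  ∀ (t : Fin p) (X X' : Vec (Fin n) k) (y : Fin n) →
  toList X ↭ toList X' → A t X y → A t X' y

record IsAugmentedArena {n p : ℕ} .{{_ : NonZero p}} (E : Snapshots n p) (k : ℕ)
       (A : HyperedgeSet n p k) : Set where
  field
    multiset : MultisetClosed A
    contains : ∀ t X y → Dk E t X y → A t X y
    copwin   : ∀ t X y → A t X y → CopWin E t X y

addHyperedge : ∀ {n p k} → HyperedgeSet n p k →
               Fin p → Vec (Fin n) k → Fin n → HyperedgeSet n p k
addHyperedge A t X y t' X' y' =
  A t' X' y' ⊎ (t' ≡ t × toList X ↭ toList X' × y' ≡ y)

ShadowCorner : ∀ {n p k} .{{_ : NonZero p}} → Snapshots n p → HyperedgeSet n p k →
               Fin p → Fin n → Vec (Fin n) k → Set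
ShadowCorner E A t y Z = ¬ (y ∈ᵐ Z) × (∀ w → E t y w → A (next t) Z w)

-- Cops at X move along the matching to the positions Z, whatever the robber
-- at y does.  The robber must then leave y along an edge of D, reaching some
-- w ∈ Γ_t(y,D) ⊆ Γ_{t+1}(Z,A^k); so (t+1,Z,w) is copwin because A^k is
-- augmented.  Since copwin configurations only depend on the multiset of cop
-- positions, every reordering of X is copwin against y as well.
module Submission where

open import Defs
open import Data.Nat using (ℕ; NonZero; _≥_)
open import Data.Fin using (Fin; cast)
open import Data.Fin.Properties using (cast-involutive)
open import Data.Fin.Permutation
  using (Permutation′; _⟨$⟩ʳ_; _⟨$⟩ˡ_; inverseʳ; _∘ₚ_; cast-id)
open import Data.Vec using (Vec; _∷_; lookup; toList; tabulate)
open import Data.Vec.Properties using (lookup∘tabulate; length-toList)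
import Data.List as List
open import Data.Product using (Σ; _,_)
open import Data.Sum using (_⊎_; inj₁; inj₂)
open import Relation.Binary.PropositionalEquality
  using (_≡_; refl; sym; trans; cong; subst; setoid; module ≡-Reasoning)
open import Data.List.Relation.Binary.Permutation.Propositional
  using (_↭_; ↭-sym; ↭-trans; ↭⇒↭ₛ)
import Data.List.Relation.Binary.Permutation.Setoid as Setoid↭
import Data.List.Relation.Binary.Permutation.Setoid.Properties as Setoid↭ₚ

lookup-toList : ∀ {A : Set} {k} (v : Vec A k) (m : Fin (List.length (toList v))) →
                List.lookup (toList v) m ≡ lookup v (cast (length-toList v) m)
lookup-toList (x ∷ v) Fin.zero    = refl
lookup-toList (x ∷ v) (Fin.suc m) = lookup-toList v m

↭⇒permutation : ∀ {A : Set} {k} (X X' : Vec A k) → toList X ↭ toList X' →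
                Σ (Permutation′ k) λ ρ → ∀ j → lookup X' j ≡ lookup X (ρ ⟨$⟩ʳ j)
↭⇒permutation {A} {k} X X' X↭X' = ρ , lookup-ρ
  where
  open Setoid↭ (setoid A) using (onIndices) renaming (_↭_ to _↭ₛ_)
  open Setoid↭ₚ (setoid A) using (onIndices-lookup)
  X'↭X : toList X' ↭ₛ toList X
  X'↭X = ↭⇒↭ₛ (↭-sym X↭X')
  ρ : Permutation′ k
  ρ = cast-id (sym (length-toList X')) ∘ₚ onIndices X'↭X ∘ₚ cast-id (length-toList X)
  lookup-ρ : ∀ j → lookup X' j ≡ lookup X (ρ ⟨$⟩ʳ j)
  lookup-ρ j = begin
    lookup X' j                                 ≡⟨ cong (lookup X') (cast-involutive ∣X'∣ (sym ∣X'∣) j) ⟨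
    lookup X' (cast ∣X'∣ (cast (sym ∣X'∣) j))    ≡⟨ lookup-toList X' _ ⟨
    List.lookup (toList X') (cast (sym ∣X'∣) j) ≡⟨ onIndices-lookup X'↭X _ ⟩
    List.lookup (toList X) _                    ≡⟨ lookup-toList X _ ⟩
    lookup X (ρ ⟨$⟩ʳ j)                         ∎
    where
    open ≡-Reasoning
    ∣X'∣ : List.length (toList X') ≡ k
    ∣X'∣ = length-toList X'

module _ {n p : ℕ} .{{_ : NonZero p}} (E : Snapshots n p) where

  -- Cop j of D shadows cop σ j of C; since σ is onto, every capture by C is a
  -- capture by D.
  CopWin-reindex : ∀ {k k'} (σ : Fin k' → Fin k) (τ : Fin k → Fin k') →
                   (∀ i → σ (τ i) ≡ i) →
                   ∀ {t C D r} → (∀ j → lookup D j ≡ lookup C (σ j)) →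
                   CopWin E t C r → CopWin E t D r
  CopWin-reindex σ τ στ {C = C} D≗C∘σ (caught (i , Ci≡r)) =
    caught (τ i , trans (D≗C∘σ (τ i)) (trans (cong (lookup C) (στ i)) Ci≡r))
  CopWin-reindex {k' = k'} σ τ στ {t} {C} {D} {r} D≗C∘σ (move C' steps reply) =
    move D' steps' (reply' reply)
    where
    D' : Vec (Fin n) k'
    D' = tabulate (λ j → lookup C' (σ j))
    D'≗C'∘σ : ∀ j → lookup D' j ≡ lookup C' (σ j)
    D'≗C'∘σ = lookup∘tabulate (λ j → lookup C' (σ j))
    steps' : ∀ j → E t (lookup D j) (lookup D' j)
    steps' j rewrite D≗C∘σ j | D'≗C'∘σ j = steps (σ j)
    reply' : r ∈ᵐ C' ⊎ (∀ r' → E t r r' → CopWin E (next t) C' r') →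
             r ∈ᵐ D' ⊎ (∀ r' → E t r r' → CopWin E (next t) D' r')
    reply' (inj₁ (i , C'i≡r)) =
      inj₁ (τ i , trans (D'≗C'∘σ (τ i)) (trans (cong (lookup C') (στ i)) C'i≡r))
    reply' (inj₂ win) = inj₂ (λ r' e → CopWin-reindex σ τ στ D'≗C'∘σ (win r' e))

  CopWin-permute : ∀ {k} (ρ : Permutation′ k) {t C D r} →
                   (∀ j → lookup D j ≡ lookup C (ρ ⟨$⟩ʳ j)) →
                   CopWin E t C r → CopWin E t D r
  CopWin-permute ρ = CopWin-reindex (ρ ⟨$⟩ʳ_) (ρ ⟨$⟩ˡ_) (λ _ → inverseʳ ρ)

  CopWin-resp-↭ : ∀ {k t r} {C D : Vec (Fin n) k} →
                  toList C ↭ toList D → CopWin E t C r → CopWin E t D r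
  CopWin-resp-↭ {C = C} {D} C↭D with ↭⇒permutation C D C↭D
  ... | ρ , D≗C∘ρ = CopWin-permute ρ D≗C∘ρ

  CopWin-moveTo : ∀ {k t y} {X Z : Vec (Fin n) k} (π : Permutation′ k) →
                  (∀ i → E t (lookup X i) (lookup Z (π ⟨$⟩ʳ i))) →
                  (∀ w → E t y w → CopWin E (next t) Z w) →
                  CopWin E t X y
  CopWin-moveTo {k} {t} {X = X} {Z} π steps win =
    move Z∘π steps' (inj₂ λ w e → CopWin-permute π Z∘π≗ (win w e))
    where
    Z∘π : Vec (Fin n) k
    Z∘π = tabulate (λ i → lookup Z (π ⟨$⟩ʳ i))
    Z∘π≗ : ∀ i → lookup Z∘π i ≡ lookup Z (π ⟨$⟩ʳ i)
    Z∘π≗ = lookup∘tabulate (λ i → lookup Z (π ⟨$⟩ʳ i))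
    steps' : ∀ i → E t (lookup X i) (lookup Z∘π i)
    steps' i = subst (E t (lookup X i)) (sym (Z∘π≗ i)) (steps i)

addHyperedge-multisetClosed : ∀ {n p k} {A : HyperedgeSet n p k} → MultisetClosed A →
                              ∀ t X y → MultisetClosed (addHyperedge A t X y)
addHyperedge-multisetClosed closed t X y t' X' X'' y' X'↭X'' (inj₁ a) =
  inj₁ (closed t' X' X'' y' X'↭X'' a)
addHyperedge-multisetClosed closed t X y t' X' X'' y' X'↭X'' (inj₂ (t'≡t , X↭X' , y'≡y)) =
  inj₂ (t'≡t , ↭-trans X↭X' X'↭X'' , y'≡y)

theorem7 : ∀ {n p : ℕ} .{{_ : NonZero p}} (E : Snapshots n p) → Playable E →
    (k : ℕ) → k ≥ 1 → (A : HyperedgeSet n p k) → IsAugmentedArena E k A →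
    (t : Fin p) (X : Vec (Fin n) k) (y : Fin n) (Z : Vec (Fin n) k) →
    Σ (Permutation′ k) (λ π → ∀ i → E t (lookup X i) (lookup Z (π ⟨$⟩ʳ i))) →
    ShadowCorner E A t y Z →
    IsAugmentedArena E k (addHyperedge A t X y)
theorem7 E _ k _ A aug t X y Z (π , matching) (_ , shadow) = record
  { multiset = addHyperedge-multisetClosed multiset t X y
  ; contains = λ t' X' y' d → inj₁ (contains t' X' y' d)
  ; copwin   = copwin′
  }
  where
  open IsAugmentedArena aug
  X-copwin : CopWin E t X y
  X-copwin = CopWin-moveTo E π matching (λ w e → copwin _ Z w (shadow w e))
  copwin′ : ∀ t' X' y' → addHyperedge A t X y t' X' y' → CopWin E t' X' y'
  copwin′ t' X' y' (inj₁ a)                    = copwin t' X' y' a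
  copwin′ t' X' y' (inj₂ (refl , X↭X' , refl)) = CopWin-resp-↭ E X↭X' X-copwin
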